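{- Let $G,H$ be graphs that are both connected and coconnected. For all $u,v\in V(G)$ and $u',v'\in V(H)$: if $u$ and $v$ lie in the same maximal module of $G$ and $u'$ and $v'$ lie in different maximal modules of $H$, then $((u,v),(u',v'))$ is a winning position for Spoiler in the bijective $3$-pebble game $\mathrm{BP}_3(G,H)$.
   Context: All graphs are finite and simple. A graph is coconnected if its complement is connected. A module of $G$ is a set $M\subseteq V(G)$ such that every vertex outside $M$ is adjacent to all or none of $M$. For a connected and coconnected graph $G$, its maximal modules are the elements of $M_G$, the inclusion-wise maximal set of pairwise disjoint modules that are proper subsets of $V(G)$; $M_G$ is a uniquely determined partition of $V(G)$. Bijective $k$-pebble game $\mathrm{BP}_k(G,H)$: positions are pairs $(\vec v,\vec w)\in V(G)^\ell\times V(H)^\ell$ with $0\le \ell\le k$. In each round Spoiler may remove one pebble pair (delete the $i$-th entry of both tuples); if he removed a pair or $\ell<k$, Duplicator chooses a bijection $b:V(G)\to V(H)$, Spoiler chooses $v\in V(G)$, and the position becomes $(\vec v v,\vec w\, b(v))$. Spoiler wins if at any point the map $v_i\mapsto w_i$ fails to preserve equality, adjacency, and non-adjacency among the pebbled vertices (i.e., the atomic types of $\vec v$ and $\vec w$ differ). A position is winning for Spoiler if Spoiler has a strategy from it guaranteeing a win. -}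

module Defs where

open import Data.Nat using (ℕ; suc; _<_)
open import Data.Bool using (Bool; true; false)
open import Data.Fin using (Fin)
open import Data.Fin.Subset using (Subset; _∈_; _∉_; _⊆_)
open import Data.Vec using (Vec; []; _∷_; lookup; removeAt; _∷ʳ_)
open import Data.Product using (Σ; ∃; _×_; _,_)
open import Data.Sum using (_⊎_)
open import Function.Bundles using (Bijection; _⤖_)
open import Relation.Binary.PropositionalEquality using (_≡_; _≢_)
open import Relation.Binary.Construct.Closure.ReflexiveTransitive using (Star)
open import Relation.Nullary using (¬_)

record Graph : Set where
  field
    n      : ℕ
    adj    : Fin n → Fin n → Bool
    sym    : ∀ x y → adj x y ≡ adj y x
    irrefl : ∀ x → adj x x ≡ false
open Graph public

V : Graph → Set
V G = Fin (n G)

Adj : (G : Graph) → V G → V G → Set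
Adj G x y = adj G x y ≡ true

CoAdj : (G : Graph) → V G → V G → Set
CoAdj G x y = (x ≢ y) × (adj G x y ≡ false)

Connected : Graph → Set
Connected G = ∀ (x y : V G) → Star (Adj G) x y

Coconnected : Graph → Set
Coconnected G = ∀ (x y : V G) → Star (CoAdj G) x y

IsModule : (G : Graph) → Subset (n G) → Set
IsModule G M = ∀ x → x ∉ M →
  (∀ y → y ∈ M → Adj G x y) ⊎ (∀ y → y ∈ M → adj G x y ≡ false)

IsProper : (G : Graph) → Subset (n G) → Set
IsProper G M = ∃ λ x → x ∉ M

IsMaxModule : (G : Graph) → Subset (n G) → Set
IsMaxModule G M = IsModule G M × IsProper G M ×
  (∀ M' → IsModule G M' → IsProper G M' → M ⊆ M' → M' ⊆ M)

SameMaxModule : (G : Graph) → V G → V G → Set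
SameMaxModule G u v = Σ (Subset (n G)) λ M → IsMaxModule G M × u ∈ M × v ∈ M

DiffMaxModules : (G : Graph) → V G → V G → Set
DiffMaxModules G u v = Σ (Subset (n G)) λ M₁ → Σ (Subset (n G)) λ M₂ →
  IsMaxModule G M₁ × IsMaxModule G M₂ × u ∈ M₁ × v ∈ M₂ × M₁ ≢ M₂

SameType : (G H : Graph) {ℓ : ℕ} → Vec (V G) ℓ → Vec (V H) ℓ → Set
SameType G H vs ws = ∀ i j →
  ((lookup vs i ≡ lookup vs j → lookup ws i ≡ lookup ws j) ×
   (lookup ws i ≡ lookup ws j → lookup vs i ≡ lookup vs j)) ×
  (adj G (lookup vs i) (lookup vs j) ≡ adj H (lookup ws i) (lookup ws j))

-- Spoiler-winning positions of BP_k(G,H) (least fixed point: Spoiler wins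
-- in finitely many rounds against every Duplicator behaviour).
data SpoilerWins (k : ℕ) (G H : Graph) : (ℓ : ℕ) → Vec (V G) ℓ → Vec (V H) ℓ → Set where
  typesDiffer : ∀ {ℓ vs ws} → ¬ SameType G H vs ws → SpoilerWins k G H ℓ vs ws
  place : ∀ {ℓ vs ws} → ℓ < k →
    (∀ (b : Fin (n G) ⤖ Fin (n H)) → ∃ λ v →
       SpoilerWins k G H (suc ℓ) (vs ∷ʳ v) (ws ∷ʳ Bijection.to b v)) →
    SpoilerWins k G H ℓ vs ws
  removePlace : ∀ {ℓ} {vs : Vec (V G) (suc ℓ)} {ws : Vec (V H) (suc ℓ)} (i : Fin (suc ℓ)) →
    (∀ (b : Fin (n G) ⤖ Fin (n H)) → ∃ λ v →
       SpoilerWins k G H (suc ℓ) (removeAt vs i ∷ʳ v) (removeAt ws i ∷ʳ Bijection.to b v)) →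
    SpoilerWins k G H (suc ℓ) vs ws

-- Let M be the maximal module containing u and v, and read adjacency as a colouring of
-- pairs.  As G is connected and coconnected there are x, o ∉ M such that all pairs x m
-- (m ∈ M) have one colour c, all pairs o m have colour not c, and o x has colour c.
-- Call w a c-separator of (p, q) if w p has colour not c and w q has colour c.  For
-- y ∈ M the separators of (u, y) lie in M and separate (u, x) as well, and o is one
-- more, so (u, x) has strictly more separators than any (u, y).  Spoiler pebbles x and
-- Duplicator answers some x′ ≠ u′.  If (u, x) and (u′, x′) have different numbers of
-- separators, every bijection mismatches a separator, which Spoiler pebbles.
-- Otherwise Spoiler drops x and follows a walk from v′ to x′ in which each vertex
-- distinguishes u′ from its predecessor, each time pebbling the preimage of the next
-- vertex: it must lie in M or the types differ.  At the end, the separator counts of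
-- (u, y) and (u′, x′) differ.  The walk exists because the closure of {u′, v′} under
-- adding such distinguishing vertices is a module, hence all of V(H) as u′ and v′ lie
-- in different maximal modules.
module Submission where

open import Data.Bool using (Bool; true; false; not; if_then_else_)
open import Data.Bool.Properties using (not-¬) renaming (_≟_ to _≟ᵇ_)
open import Data.Empty using (⊥-elim)
open import Data.Fin using (Fin; zero; suc)
open import Data.Fin.Patterns using (0F; 1F; 2F)
open import Data.Fin.Properties using (any?; ¬∀⟶∃¬) renaming (_≟_ to _≟ᶠ_)
open import Data.Fin.Subset using (Subset; _∈_; _∉_; _⊆_; _⊂_; _⊃_; _∪_; ⁅_⁆; ∣_∣)
open import Data.Fin.Subset.Induction using (⊃-wellFounded)
open import Data.Fin.Subset.Properties
  using (_∈?_; x∈p∪q⁺; x∈p∪q⁻; p⊆p∪q; ⊆-trans; ⊆-antisym; x∈⁅x⁆; x∈⁅y⁆⇒x≡y; p⊂q⇒∣p∣<∣q∣)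
open import Data.Nat using (ℕ; zero; suc; _<_; z≤n; s≤s)
open import Data.Nat.Properties using (<⇒≢; +-0-commutativeMonoid) renaming (_≟_ to _≟ⁿ_)
open import Data.Product using (∃; ∃₂; _×_; _,_; proj₁; proj₂)
open import Data.Sum using (_⊎_; inj₁; inj₂; [_,_]; fromInj₁; fromInj₂)
open import Data.Vec using (Vec; []; _∷_; _∷ʳ_; tabulate)
open import Data.Vec.Properties using (lookup∘tabulate; tabulate-cong; []=⇒lookup; lookup⇒[]=)
open import Defs renaming (sym to adj-sym)
open import Function using (_∘_; id)
open import Function.Bundles using (Bijection; _⤖_)
open import Function.Properties.Bijection using (⤖⇒↔)
open import Induction.WellFounded using (Acc; acc)
open import Level using (Level; 0ℓ)
open import Relation.Binary using (Rel)
open import Relation.Binary.Construct.Closure.ReflexiveTransitive using (Star; ε; _◅_; _◅◅_)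
import Relation.Binary.Definitions as B
open import Relation.Binary.PropositionalEquality
  using (_≡_; _≢_; refl; sym; trans; cong; cong₂; subst)
open import Relation.Nullary using (¬_; Dec; does; yes; no; ¬?; contradiction)
open import Relation.Nullary.Decidable using (_×-dec_; dec-true; decidable-stable)
open import Relation.Unary using (Pred; Decidable)

open import Algebra.Properties.CommutativeMonoid.Sum +-0-commutativeMonoid using (sum; sum-permute)

private
  variable
    ℓ : Level
    m m′ : ℕ

⟦_⟧ : {P : Pred (Fin m) ℓ} → Decidable P → Subset m
⟦ P? ⟧ = tabulate (does ∘ P?)

∈-tabulate⁺ : {f : Fin m → Bool} {x : Fin m} → f x ≡ true → x ∈ tabulate f
∈-tabulate⁺ {f = f} {x} fx = lookup⇒[]= x _ (trans (lookup∘tabulate f x) fx)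

∈-tabulate⁻ : {f : Fin m → Bool} {x : Fin m} → x ∈ tabulate f → f x ≡ true
∈-tabulate⁻ {f = f} {x} x∈ = trans (sym (lookup∘tabulate f x)) ([]=⇒lookup x∈)

∈⟦⟧⁺ : {P : Pred (Fin m) ℓ} (P? : Decidable P) {x : Fin m} → P x → x ∈ ⟦ P? ⟧
∈⟦⟧⁺ P? {x} px = ∈-tabulate⁺ (dec-true (P? x) px)

∈⟦⟧⁻ : {P : Pred (Fin m) ℓ} (P? : Decidable P) {x : Fin m} → x ∈ ⟦ P? ⟧ → P x
∈⟦⟧⁻ P? {x} x∈ with P? x | ∈-tabulate⁻ {f = does ∘ P?} x∈
... | yes px | _ = px

indicator : Bool → ℕ
indicator b = if b then 1 else 0

∣tabulate∣≡∑ : (f : Fin m → Bool) → ∣ tabulate f ∣ ≡ sum (indicator ∘ f)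
∣tabulate∣≡∑ {zero}  f = refl
∣tabulate∣≡∑ {suc m} f with f zero
... | true  = cong suc (∣tabulate∣≡∑ (f ∘ suc))
... | false = ∣tabulate∣≡∑ (f ∘ suc)

∣tabulate∘bijection∣ : (b : Fin m ⤖ Fin m′) (g : Fin m′ → Bool) →
  ∣ tabulate (g ∘ Bijection.to b) ∣ ≡ ∣ tabulate g ∣
∣tabulate∘bijection∣ b g = trans (∣tabulate∣≡∑ (g ∘ Bijection.to b))
  (trans (sym (sum-permute (indicator ∘ g) (⤖⇒↔ b))) (sym (∣tabulate∣≡∑ g)))

∣tabulate∣-mismatch : {f : Fin m → Bool} {g : Fin m′ → Bool} → ∣ tabulate f ∣ ≢ ∣ tabulate g ∣ →
  (b : Fin m ⤖ Fin m′) → ∃ λ x → f x ≢ g (Bijection.to b x)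
∣tabulate∣-mismatch {m} {f = f} {g} ∣f∣≢∣g∣ b =
  ¬∀⟶∃¬ m _ (λ x → f x ≟ᵇ g (Bijection.to b x))
    (λ f≗g∘b → ∣f∣≢∣g∣ (trans (cong ∣_∣ (tabulate-cong f≗g∘b)) (∣tabulate∘bijection∣ b g)))

star-crossing : {R : Rel (Fin m) ℓ} {S : Subset m} {x y : Fin m} → Star R x y → x ∈ S → y ∉ S →
  ∃₂ λ r t → r ∈ S × t ∉ S × R r t
star-crossing ε x∈ x∉ = ⊥-elim (x∉ x∈)
star-crossing {S = S} (_◅_ {j = j} r path) x∈ y∉ with j ∈? S
... | yes j∈ = star-crossing path j∈ y∉
... | no j∉  = _ , _ , x∈ , j∉ , r

ClosedUnder : Rel (Fin m) ℓ → Subset m → Set ℓ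
ClosedUnder R C = ∀ {t y} → t ∈ C → y ∉ C → ¬ R t y

Reachable : Rel (Fin m) ℓ → Subset m → Fin m → Set ℓ
Reachable R S z = ∃ λ x → x ∈ S × Star R x z

Closure : Rel (Fin m) ℓ → Subset m → Set ℓ
Closure R S = ∃ λ C → S ⊆ C × ClosedUnder R C × (∀ {z} → z ∈ C → Reachable R S z)

closure : {R : Rel (Fin m) ℓ} → B.Decidable R → (S : Subset m) → Closure R S
closure {R = R} R? S = grow S (⊃-wellFounded S) id (λ z∈ → _ , z∈ , ε)
  where
  grow : ∀ C → Acc _⊃_ C → S ⊆ C → (∀ {z} → z ∈ C → Reachable R S z) → Closure R S
  grow C (acc rec) S⊆C reach with any? (λ t → any? (λ y → t ∈? C ×-dec ¬? (y ∈? C) ×-dec R? t y))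
  ... | no none = C , S⊆C , (λ t∈ y∉ r → none (_ , _ , t∈ , y∉ , r)) , reach
  ... | yes (t , y , t∈ , y∉ , r) =
    grow (C ∪ ⁅ y ⁆) (rec C⊂C∪y) (⊆-trans S⊆C (p⊆p∪q _)) reach′
    where
    C⊂C∪y : C ⊂ C ∪ ⁅ y ⁆
    C⊂C∪y = p⊆p∪q ⁅ y ⁆ , y , x∈p∪q⁺ (inj₂ (x∈⁅x⁆ y)) , y∉
    reach′ : ∀ {z} → z ∈ C ∪ ⁅ y ⁆ → Reachable R S z
    reach′ z∈ with x∈p∪q⁻ C ⁅ y ⁆ z∈
    ... | inj₁ z∈C = reach z∈C
    ... | inj₂ z∈⁅y⁆ with refl ← x∈⁅y⁆⇒x≡y y z∈⁅y⁆ with reach t∈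
    ...   | x , x∈S , path = x , x∈S , path ◅◅ (r ◅ ε)

module _ (G : Graph) where

  module-uniform : {M : Subset (n G)} → IsModule G M → ∀ {x a b} → x ∉ M → a ∈ M → b ∈ M →
    adj G x a ≡ adj G x b
  module-uniform mM {x} x∉ a∈ b∈ with mM x x∉
  ... | inj₁ all  = trans (all _ a∈) (sym (all _ b∈))
  ... | inj₂ none = trans (none _ a∈) (sym (none _ b∈))

  ∪-module : {A B : Subset (n G)} {x : V G} → IsModule G A → IsModule G B → x ∈ A → x ∈ B →
    IsModule G (A ∪ B)
  ∪-module {A} {B} mA mB x∈A x∈B z z∉ with mA z (z∉ ∘ x∈p∪q⁺ ∘ inj₁) | mB z (z∉ ∘ x∈p∪q⁺ ∘ inj₂)
  ... | inj₁ allA  | inj₁ allB  = inj₁ λ y → [ allA y , allB y ] ∘ x∈p∪q⁻ A B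
  ... | inj₂ noneA | inj₂ noneB = inj₂ λ y → [ noneA y , noneB y ] ∘ x∈p∪q⁻ A B
  ... | inj₁ allA  | inj₂ noneB = contradiction (trans (sym (allA _ x∈A)) (noneB _ x∈B)) λ ()
  ... | inj₂ noneA | inj₁ allB  = contradiction (trans (sym (allB _ x∈B)) (noneA _ x∈A)) λ ()

  module _ (conG : Connected G) (coG : Coconnected G) where

    crossing-edge : {S : Subset (n G)} {x y : V G} → x ∈ S → y ∉ S → ∀ β →
      ∃₂ λ r t → r ∈ S × t ∉ S × adj G r t ≡ β
    crossing-edge x∈ y∉ true = star-crossing (conG _ _) x∈ y∉
    crossing-edge x∈ y∉ false with star-crossing (coG _ _) x∈ y∉
    ... | r , t , r∈ , t∉ , (_ , rt) = r , t , r∈ , t∉ , rt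

    uniform-outside : {M : Subset (n G)} {u : V G} → IsModule G M → IsProper G M → u ∈ M →
      ∀ β → ∃ λ t → t ∉ M × ∀ {w} → w ∈ M → adj G t w ≡ β
    uniform-outside mM (y , y∉) u∈ β with crossing-edge u∈ y∉ β
    ... | r , t , r∈ , t∉ , rt≡β =
      t , t∉ , λ w∈ → trans (module-uniform mM t∉ w∈ r∈) (trans (adj-sym G t r) rt≡β)

    -- All edges between B and its complement would have the colour of p q.
    proper-modules-¬cover : {A B : Subset (n G)} → IsModule G A → IsModule G B →
      IsProper G A → IsProper G B → ¬ (∀ z → z ∈ A ⊎ z ∈ B)
    proper-modules-¬cover {A} {B} mA mB (p , p∉A) (q , q∉B) cover =
      refute (crossing-edge (inB p∉A) q∉B (not (adj G p q)))
      where
      inA : ∀ {z} → z ∉ B → z ∈ A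
      inA z∉B = fromInj₁ (⊥-elim ∘ z∉B) (cover _)
      inB : ∀ {z} → z ∉ A → z ∈ B
      inB z∉A = fromInj₂ (⊥-elim ∘ z∉A) (cover _)
      homogeneous : ∀ {r t} → r ∉ B → t ∈ B → adj G r t ≡ adj G p q
      homogeneous {r} r∉B t∈B = trans (module-uniform mB r∉B t∈B (inB p∉A))
        (trans (adj-sym G r p) (module-uniform mA p∉A (inA r∉B) (inA q∉B)))
      refute : ¬ (∃₂ λ r t → r ∈ B × t ∉ B × adj G r t ≡ not (adj G p q))
      refute (r , t , r∈B , t∉B , rt) = not-¬ (trans (adj-sym G r t) (homogeneous t∉B r∈B)) rt

    maxModule-absorbs : {A B : Subset (n G)} {x : V G} → IsMaxModule G A → IsModule G B →
      IsProper G B → x ∈ A → x ∈ B → B ⊆ A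
    maxModule-absorbs {A} {B} (mA , prA , maxA) mB prB x∈A x∈B with any? (λ z → ¬? (z ∈? A ∪ B))
    ... | yes prA∪B = λ z∈B →
      maxA (A ∪ B) (∪-module mA mB x∈A x∈B) prA∪B (p⊆p∪q B) (x∈p∪q⁺ (inj₂ z∈B))
    ... | no ¬prA∪B = ⊥-elim (proper-modules-¬cover mA mB prA prB λ z →
      x∈p∪q⁻ A B (decidable-stable (z ∈? A ∪ B) (¬prA∪B ∘ (z ,_))))

    maxModule-unique : {A B : Subset (n G)} {x : V G} → IsMaxModule G A → IsMaxModule G B →
      x ∈ A → x ∈ B → A ≡ B
    maxModule-unique maxA@(mA , prA , _) maxB@(mB , prB , _) x∈A x∈B =
      ⊆-antisym (maxModule-absorbs maxB mA prA x∈B x∈A) (maxModule-absorbs maxA mB prB x∈A x∈B)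

Splitter : (H : Graph) → V H → Rel (V H) 0ℓ
Splitter H a t y = adj H y a ≢ adj H y t

splitter? : (H : Graph) (a : V H) → B.Decidable (Splitter H a)
splitter? H a t y = ¬? (adj H y a ≟ᵇ adj H y t)

module _ (H : Graph) {a : V H} where

  splitter-walk-from-self : ∀ {z} → Star (Splitter H a) a z → z ≡ a
  splitter-walk-from-self ε = refl
  splitter-walk-from-self (split ◅ _) = contradiction refl split

  splitter-closed⇒module : {C : Subset (n H)} → ClosedUnder (Splitter H a) C → IsModule H C
  splitter-closed⇒module {C} closed y y∉ = by-colour (adj H y a) refl
    where
    agrees : ∀ {t} → t ∈ C → adj H y t ≡ adj H y a
    agrees t∈ = sym (decidable-stable (_ ≟ᵇ _) (closed t∈ y∉))
    by-colour : ∀ β → adj H y a ≡ β →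
      (∀ t → t ∈ C → Adj H y t) ⊎ (∀ t → t ∈ C → adj H y t ≡ false)
    by-colour true  e = inj₁ λ _ t∈ → trans (agrees t∈) e
    by-colour false e = inj₂ λ _ t∈ → trans (agrees t∈) e

  diffMaxModules⇒splitter-walk : Connected H → Coconnected H → ∀ {s} → DiffMaxModules H a s →
    ∀ {z} → z ≢ a → Star (Splitter H a) s z
  diffMaxModules⇒splitter-walk conH coH {s} (M₁ , M₂ , max₁ , max₂ , a∈M₁ , s∈M₂ , M₁≢M₂) {z} z≢a
    with closure (splitter? H a) (⁅ a ⁆ ∪ ⁅ s ⁆)
  ... | C , start⊆C , closed , reach with any? (λ x → ¬? (x ∈? C))
  ...   | yes prC = ⊥-elim (M₁≢M₂ (maxModule-unique H conH coH max₁ max₂ s∈M₁ s∈M₂))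
    where
    s∈M₁ : s ∈ M₁
    s∈M₁ = maxModule-absorbs H conH coH max₁ (splitter-closed⇒module closed) prC a∈M₁
      (start⊆C (x∈p∪q⁺ (inj₁ (x∈⁅x⁆ a)))) (start⊆C (x∈p∪q⁺ (inj₂ (x∈⁅x⁆ s))))
  ...   | no ¬prC with reach (decidable-stable (z ∈? C) (¬prC ∘ (z ,_)))
  ...     | x , x∈start , walk with x∈p∪q⁻ ⁅ a ⁆ ⁅ s ⁆ x∈start
  ...       | inj₁ x∈⁅a⁆ with refl ← x∈⁅y⁆⇒x≡y a x∈⁅a⁆ = contradiction (splitter-walk-from-self walk) z≢a
  ...       | inj₂ x∈⁅s⁆ with refl ← x∈⁅y⁆⇒x≡y s x∈⁅s⁆ = walk

Separator : (X : Graph) → Bool → V X → V X → Pred (V X) 0ℓ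
Separator X c p q w = adj X w p ≡ not c × adj X w q ≡ c

separatorColours? : (c α β : Bool) → Dec (α ≡ not c × β ≡ c)
separatorColours? c α β = (α ≟ᵇ not c) ×-dec (β ≟ᵇ c)

separator? : (X : Graph) (c : Bool) (p q : V X) → Decidable (Separator X c p q)
separator? X c p q w = separatorColours? c (adj X w p) (adj X w q)

separators : (X : Graph) → Bool → V X → V X → Subset (n X)
separators X c p q = ⟦ separator? X c p q ⟧

module _ (G : Graph) {M : Subset (n G)} (mM : IsModule G M) {u : V G} (u∈M : u ∈ M) where

  separators⊆module : ∀ {c y} → y ∈ M → separators G c u y ⊆ M
  separators⊆module {c} {y} y∈M {w} w∈ with ∈⟦⟧⁻ (separator? G c u y) w∈
  ... | wu≡¬c , wy≡c = decidable-stable (w ∈? M) λ w∉M →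
    not-¬ refl (sym (trans (sym wu≡¬c) (trans (module-uniform G mM w∉M u∈M y∈M) wy≡c)))

  separators⊂ : ∀ {c x o y} → (∀ {w} → w ∈ M → adj G x w ≡ c) →
    o ∉ M → (∀ {w} → w ∈ M → adj G o w ≡ not c) → adj G o x ≡ c →
    y ∈ M → separators G c u y ⊂ separators G c u x
  separators⊂ {c} {x} {o} {y} x-uniform o∉M o-uniform ox≡c y∈M =
    (λ {w} w∈ → ∈⟦⟧⁺ (separator? G c u x) (proj₁ (∈⟦⟧⁻ (separator? G c u y) w∈) ,
                      trans (adj-sym G w x) (x-uniform (separators⊆module y∈M w∈)))) ,
    o , ∈⟦⟧⁺ (separator? G c u x) (o-uniform u∈M , ox≡c) , o∉M ∘ separators⊆module y∈M

  -- c is the colour of the edge between the two uniform vertices: then the one of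
  -- colour not c is a separator of (u, x) outside M.
  separator-gap : Connected G → Coconnected G → IsProper G M →
    ∃₂ λ c x → x ∉ M × ∀ {y} → y ∈ M → ∣ separators G c u y ∣ < ∣ separators G c u x ∣
  separator-gap conG coG prM
    with uniform-outside G conG coG mM prM u∈M true | uniform-outside G conG coG mM prM u∈M false
  ... | t₁ , t₁∉M , t₁-uniform | t₀ , t₀∉M , t₀-uniform with adj G t₀ t₁ in e
  ...   | true  = true , t₁ , t₁∉M ,
    p⊂q⇒∣p∣<∣q∣ ∘ separators⊂ t₁-uniform t₀∉M t₀-uniform e
  ...   | false = false , t₀ , t₀∉M ,
    p⊂q⇒∣p∣<∣q∣ ∘ separators⊂ t₀-uniform t₁∉M t₁-uniform (trans (adj-sym G t₁ t₀) e)

module _ {k : ℕ} {G H : Graph} where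

  WinsByPlacing : ∀ {len} → Vec (V G) len → Vec (V H) len → Set
  WinsByPlacing {len} vs ws = ∀ (b : V G ⤖ V H) → ∃ λ v →
    SpoilerWins k G H (suc len) (vs ∷ʳ v) (ws ∷ʳ Bijection.to b v)

  sameType⇒adj-last : ∀ {p q w p′ q′ w′} →
    SameType G H (p ∷ q ∷ w ∷ []) (p′ ∷ q′ ∷ w′ ∷ []) →
    adj G w p ≡ adj H w′ p′ × adj G w q ≡ adj H w′ q′
  sameType⇒adj-last st = proj₂ (st 2F 0F) , proj₂ (st 2F 1F)

  separator-counts-differ⇒wins : ∀ {c p q p′ q′} →
    ∣ separators G c p q ∣ ≢ ∣ separators H c p′ q′ ∣ → WinsByPlacing (p ∷ q ∷ []) (p′ ∷ q′ ∷ [])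
  separator-counts-differ⇒wins {c} counts-differ b with ∣tabulate∣-mismatch counts-differ b
  ... | w , mismatch = w , typesDiffer λ st →
    let wp≡ , wq≡ = sameType⇒adj-last st
    in mismatch (cong₂ (λ α β → does (separatorColours? c α β)) wp≡ wq≡)

  module _ {M : Subset (n G)} (mM : IsModule G M) {u : V G} (u∈M : u ∈ M)
           {u′ z′ : V H} {c : Bool}
           (far : ∀ {y} → y ∈ M → ∣ separators G c u y ∣ ≢ ∣ separators H c u′ z′ ∣) where

    splitter-walk⇒wins : ∀ {s′ y} → Star (Splitter H u′) s′ z′ → y ∈ M →
      WinsByPlacing (u ∷ y ∷ []) (u′ ∷ s′ ∷ [])
    splitter-walk⇒wins ε y∈M = separator-counts-differ⇒wins (far y∈M)
    splitter-walk⇒wins {s′} {y} (split ◅ walk) y∈M b with Bijection.strictlySurjective b _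
    ... | w , bw≡s₁ with w ∈? M
    ...   | yes w∈M = w , removePlace 1F
      (subst (λ t → WinsByPlacing (u ∷ w ∷ []) (u′ ∷ t ∷ [])) (sym bw≡s₁) (splitter-walk⇒wins walk w∈M))
    ...   | no w∉M = w , typesDiffer λ st →
      let wu≡ , wy≡ = sameType⇒adj-last st
      in split (subst (λ t → adj H t u′ ≡ adj H t s′) bw≡s₁
                 (trans (sym wu≡) (trans (module-uniform G mM w∉M u∈M y∈M) wy≡)))

  separator-gap⇒wins : ∀ {M : Subset (n G)} {u v : V G} {u′ v′ : V H} {c : Bool} {x : V G} →
    2 < k → IsModule G M → u ∈ M → v ∈ M → x ∉ M →
    (∀ {y} → y ∈ M → ∣ separators G c u y ∣ < ∣ separators G c u x ∣) →
    (∀ {z} → z ≢ u′ → Star (Splitter H u′) v′ z) →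
    SpoilerWins k G H 2 (u ∷ v ∷ []) (u′ ∷ v′ ∷ [])
  separator-gap⇒wins {M} {u} {v} {u′} {v′} {c} {x} 2<k mM u∈M v∈M x∉M gap walk =
    place 2<k λ f → x , respond f
    where
    respond : ∀ f → SpoilerWins k G H 3 (u ∷ v ∷ x ∷ []) (u′ ∷ v′ ∷ Bijection.to f x ∷ [])
    respond f with Bijection.to f x ≟ᶠ u′
    ... | yes fx≡u′ = typesDiffer λ st →
      x∉M (subst (_∈ M) (sym (proj₂ (proj₁ (st 2F 0F)) fx≡u′)) u∈M)
    ... | no fx≢u′ with ∣ separators G c u x ∣ ≟ⁿ ∣ separators H c u′ (Bijection.to f x) ∣
    ...   | no counts-differ = removePlace 1F (separator-counts-differ⇒wins counts-differ)
    ...   | yes counts-agree = removePlace 2F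
      (splitter-walk⇒wins mM u∈M (λ y∈M e → <⇒≢ (gap y∈M) (trans e (sym counts-agree)))
        (walk fx≢u′) v∈M)

lemma4p10 : (G H : Graph) → Connected G → Coconnected G → Connected H → Coconnected H →
    (u v : V G) (u' v' : V H) → SameMaxModule G u v → DiffMaxModules H u' v' →
    SpoilerWins 3 G H 2 (u ∷ v ∷ []) (u' ∷ v' ∷ [])
lemma4p10 G H conG coG conH coH u v u' v' (M , (mM , prM , _) , u∈M , v∈M) diff
  with separator-gap G mM u∈M conG coG prM
... | c , x , x∉M , gap = separator-gap⇒wins (s≤s (s≤s (s≤s z≤n))) mM u∈M v∈M x∉M gap
  (diffMaxModules⇒splitter-walk H conH coH diff)
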